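{- With $$K_n=\prod_{b=0}^{2^n-1}\frac{3^{M_{n-1}(b)}}{2^n},$$ one has $\lim_{n\to\infty}K_n=0$.
   Context: Let $T^1:\mathbb{N}\to\mathbb{N}$ be the Collatz function, $T^1(N)=N/2$ if $N$ is even and $T^1(N)=\frac{3N+1}{2}$ if $N$ is odd; in particular $T^1(0)=0$. Write $T^1_k$ for the $k$-th iterate of $T^1$, with $T^1_0$ the identity. For an integer $n\ge1$ and $b\in\{0,\dots,2^n-1\}$, let $M_{n-1}(b)$ be the number of odd integers among $b, T^1_1(b),\dots,T^1_{n-1}(b)$. In particular $M_{n-1}(0)=0$. -}

module Defs where

open import Data.Nat using (ℕ; zero; suc; _+_; _*_; _^_)
open import Data.Nat.DivMod using (_/_; _%_)
open import Data.Nat.Properties using (m^n≢0)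
open import Data.Integer using (+_)
open import Data.Rational using (ℚ; 1ℚ) renaming (_/_ to _/ℚ_; _*_ to _*ℚ_)
open import Data.List using (List; upTo; foldr; map)

T1 : ℕ → ℕ
T1 N with N % 2
... | zero  = N / 2
... | suc _ = (3 * N + 1) / 2

T1^ : ℕ → ℕ → ℕ
T1^ zero    N = N
T1^ (suc k) N = T1^ k (T1 N)

oddInd : ℕ → ℕ
oddInd N with N % 2
... | zero  = 0
... | suc _ = 1

-- Mcount n b = number of odd integers among T¹_0(b), …, T¹_{n-1}(b).
-- For n ≥ 1 this is the paper's M_{n-1}(b).
Mcount : ℕ → ℕ → ℕ
Mcount zero    b = 0
Mcount (suc n) b = oddInd (T1^ n b) + Mcount n b

prodℚ : List ℚ → ℚ
prodℚ = foldr _*ℚ_ 1ℚ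

K : ℕ → ℚ
K n = prodℚ (map (λ b → _/ℚ_ (+ (3 ^ Mcount n b)) (2 ^ n) {{m^n≢0 2 n}}) (upTo (2 ^ n)))

module Submission where

-- Residues that agree modulo 2^k follow the same first k parity steps:
-- T¹_k (r + 2^k m) = T¹_k r + 3^(M r) m. Hence M_{n-1} is 2^n-periodic, and the n-th iterates of r and
-- r + 2^n differ by an odd number, so exactly one of them is odd. Summing over b < 2^(n+1) gives
-- S_{n+1} = 2^n + 2 S_n for S_n = Σ_{b < 2^n} M_{n-1}(b), i.e. 2 S_n = n 2^n. Thus K_n = 3^S / 2^(n 2^n)
-- = (3/4)^S with S = S_n ≥ n, and (3/4)^S < 1/d as soon as S ≥ 3d, since 4^S ≥ 3^(S-1) (3 + S).

open import Defs
open import Data.List using (map; applyUpTo)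
open import Data.Nat using (ℕ; zero; suc; _+_; _*_; _^_; _/_; _≤_; z≤n; NonZero)
import Data.Nat as ℕ
open import Data.Nat.DivMod using (m*n%n≡0; m*n/n≡m; [m+kn]%n≡m%n)
open import Data.Nat.Properties
open import Data.Nat.Tactic.RingSolver using (solve-∀)
open import Data.Integer using (+0; +[1+_]; -[1+_])
import Data.Integer as ℤ
import Data.Integer.Properties as ℤ
open import Data.Rational using (ℚ; mkℚ; 0ℚ; _<_; _-_; ∣_∣; toℚᵘ)
import Data.Rational as ℚ
import Data.Rational.Properties as ℚ
open import Data.Rational.Unnormalised using (mkℚᵘ; _≃_)
import Data.Rational.Unnormalised as ℚᵘ
import Data.Rational.Unnormalised.Properties as ℚᵘ
open import Data.Product using (∃-syntax; _,_)
open import Function using (_∘_; id)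
open import Relation.Binary.PropositionalEquality

data ParityView : ℕ → Set where
  even : ∀ a → ParityView (a * 2)
  odd  : ∀ a → ParityView (1 + a * 2)

parityView : ∀ n → ParityView n
parityView zero = even 0
parityView (suc n) with parityView n
... | even a = odd a
... | odd  a = even (suc a)

oddInd-+-*2 : ∀ r x → oddInd (r + x * 2) ≡ oddInd r
oddInd-+-*2 r x rewrite [m+kn]%n≡m%n r x 2 {{_}} = refl

oddInd-even : ∀ a → oddInd (a * 2) ≡ 0
oddInd-even = oddInd-+-*2 0

oddInd-odd : ∀ a → oddInd (1 + a * 2) ≡ 1
oddInd-odd = oddInd-+-*2 1

oddInd-suc : ∀ x → oddInd x + oddInd (suc x) ≡ 1
oddInd-suc x with parityView x
... | even a = cong₂ _+_ (oddInd-even a) (oddInd-odd a)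
... | odd  a = cong₂ _+_ (oddInd-odd a) (oddInd-even (suc a))

oddInd-+-3^* : ∀ x n m → oddInd (x + 3 ^ n * m) ≡ oddInd (x + m)
oddInd-+-3^* x zero    m = cong (oddInd ∘ (x +_)) (*-identityˡ m)
oddInd-+-3^* x (suc n) m = begin
  oddInd (x + 3 * 3 ^ n * m)               ≡⟨ cong oddInd (split x (3 ^ n) m) ⟩
  oddInd (x + 3 ^ n * m + 3 ^ n * m * 2)   ≡⟨ oddInd-+-*2 (x + 3 ^ n * m) (3 ^ n * m) ⟩
  oddInd (x + 3 ^ n * m)                   ≡⟨ oddInd-+-3^* x n m ⟩
  oddInd (x + m)                           ∎
  where
  open ≡-Reasoning
  split : ∀ x y m → x + 3 * y * m ≡ x + y * m + y * m * 2
  split = solve-∀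

T1-even : ∀ a → T1 (a * 2) ≡ a
T1-even a rewrite m*n%n≡0 a 2 {{_}} = m*n/n≡m a 2

T1-odd : ∀ a → T1 (1 + a * 2) ≡ 2 + 3 * a
T1-odd a rewrite [m+kn]%n≡m%n 1 a 2 {{_}} =
  trans (cong (_/ 2) (3[1+2a]+1≡[2+3a]*2 a)) (m*n/n≡m (2 + 3 * a) 2)
  where
  3[1+2a]+1≡[2+3a]*2 : ∀ a → 3 * (1 + a * 2) + 1 ≡ (2 + 3 * a) * 2
  3[1+2a]+1≡[2+3a]*2 = solve-∀

T1-+-*2 : ∀ r x → T1 (r + x * 2) ≡ T1 r + 3 ^ oddInd r * x
T1-+-*2 r x with parityView r
... | even a = begin
  T1 (a * 2 + x * 2)                   ≡⟨ cong T1 (*-distribʳ-+ 2 a x) ⟨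
  T1 ((a + x) * 2)                     ≡⟨ T1-even (a + x) ⟩
  a + x                                ≡⟨ cong (a +_) (*-identityˡ x) ⟨
  a + 1 * x                            ≡⟨ cong₂ (λ t o → t + 3 ^ o * x) (T1-even a) (oddInd-even a) ⟨
  T1 (a * 2) + 3 ^ oddInd (a * 2) * x  ∎
  where open ≡-Reasoning
... | odd a = begin
  T1 (1 + a * 2 + x * 2)                       ≡⟨ cong (T1 ∘ suc) (*-distribʳ-+ 2 a x) ⟨
  T1 (1 + (a + x) * 2)                         ≡⟨ T1-odd (a + x) ⟩
  2 + 3 * (a + x)                              ≡⟨ cong (2 +_) (*-distribˡ-+ 3 a x) ⟩
  2 + 3 * a + 3 * x                            ≡⟨ cong₂ (λ t o → t + 3 ^ o * x) (T1-odd a) (oddInd-odd a) ⟨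
  T1 (1 + a * 2) + 3 ^ oddInd (1 + a * 2) * x  ∎
  where open ≡-Reasoning

Mcount-suc : ∀ k r → Mcount (suc k) r ≡ oddInd r + Mcount k (T1 r)
Mcount-suc zero    r = refl
Mcount-suc (suc k) r = begin
  oddInd (T1^ k (T1 r)) + Mcount (suc k) r             ≡⟨ cong (oddInd (T1^ k (T1 r)) +_) (Mcount-suc k r) ⟩
  oddInd (T1^ k (T1 r)) + (oddInd r + Mcount k (T1 r)) ≡⟨ +-swapˡ (oddInd (T1^ k (T1 r))) (oddInd r) (Mcount k (T1 r)) ⟩
  oddInd r + (oddInd (T1^ k (T1 r)) + Mcount k (T1 r)) ∎
  where
  open ≡-Reasoning
  +-swapˡ : ∀ x y z → x + (y + z) ≡ y + (x + z)
  +-swapˡ = solve-∀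

2^suc*≡2^**2 : ∀ k m → 2 ^ suc k * m ≡ 2 ^ k * m * 2
2^suc*≡2^**2 k m = trans (*-assoc 2 (2 ^ k) m) (*-comm 2 (2 ^ k * m))

T1-+-2^suc* : ∀ k r m → T1 (r + 2 ^ suc k * m) ≡ T1 r + 2 ^ k * (3 ^ oddInd r * m)
T1-+-2^suc* k r m = begin
  T1 (r + 2 ^ suc k * m)             ≡⟨ cong (T1 ∘ (r +_)) (2^suc*≡2^**2 k m) ⟩
  T1 (r + 2 ^ k * m * 2)             ≡⟨ T1-+-*2 r (2 ^ k * m) ⟩
  T1 r + 3 ^ oddInd r * (2 ^ k * m)  ≡⟨ cong (T1 r +_) (*-swapˡ (3 ^ oddInd r) (2 ^ k) m) ⟩
  T1 r + 2 ^ k * (3 ^ oddInd r * m)  ∎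
  where
  open ≡-Reasoning
  *-swapˡ : ∀ x y z → x * (y * z) ≡ y * (x * z)
  *-swapˡ = solve-∀

-- Each odd step multiplies the offset by 3, each step halves it.
T1^-+-2^* : ∀ k r m → T1^ k (r + 2 ^ k * m) ≡ T1^ k r + 3 ^ Mcount k r * m
T1^-+-2^* zero    r m = refl
T1^-+-2^* (suc k) r m = begin
  T1^ k (T1 (r + 2 ^ suc k * m))                          ≡⟨ cong (T1^ k) (T1-+-2^suc* k r m) ⟩
  T1^ k (T1 r + 2 ^ k * (3 ^ oddInd r * m))               ≡⟨ T1^-+-2^* k (T1 r) (3 ^ oddInd r * m) ⟩
  T1^ k (T1 r) + 3 ^ Mcount k (T1 r) * (3 ^ oddInd r * m) ≡⟨ cong (T1^ k (T1 r) +_) powers ⟩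
  T1^ k (T1 r) + 3 ^ Mcount (suc k) r * m                 ∎
  where
  open ≡-Reasoning
  powers : 3 ^ Mcount k (T1 r) * (3 ^ oddInd r * m) ≡ 3 ^ Mcount (suc k) r * m
  powers = begin
    3 ^ Mcount k (T1 r) * (3 ^ oddInd r * m) ≡⟨ *-assoc (3 ^ Mcount k (T1 r)) (3 ^ oddInd r) m ⟨
    3 ^ Mcount k (T1 r) * 3 ^ oddInd r * m   ≡⟨ cong (_* m) (^-distribˡ-+-* 3 (Mcount k (T1 r)) (oddInd r)) ⟨
    3 ^ (Mcount k (T1 r) + oddInd r) * m     ≡⟨ cong (λ e → 3 ^ e * m) (+-comm (Mcount k (T1 r)) (oddInd r)) ⟩
    3 ^ (oddInd r + Mcount k (T1 r)) * m     ≡⟨ cong (λ e → 3 ^ e * m) (Mcount-suc k r) ⟨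
    3 ^ Mcount (suc k) r * m                 ∎

Mcount-+-2^* : ∀ k r m → Mcount k (r + 2 ^ k * m) ≡ Mcount k r
Mcount-+-2^* zero    r m = refl
Mcount-+-2^* (suc k) r m = begin
  Mcount (suc k) (r + 2 ^ suc k * m)                              ≡⟨ Mcount-suc k (r + 2 ^ suc k * m) ⟩
  oddInd (r + 2 ^ suc k * m) + Mcount k (T1 (r + 2 ^ suc k * m))  ≡⟨ cong₂ _+_ same-parity same-tail ⟩
  oddInd r + Mcount k (T1 r)                                      ≡⟨ Mcount-suc k r ⟨
  Mcount (suc k) r                                                ∎
  where
  open ≡-Reasoning
  same-parity : oddInd (r + 2 ^ suc k * m) ≡ oddInd r
  same-parity = trans (cong (oddInd ∘ (r +_)) (2^suc*≡2^**2 k m)) (oddInd-+-*2 r (2 ^ k * m))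
  same-tail : Mcount k (T1 (r + 2 ^ suc k * m)) ≡ Mcount k (T1 r)
  same-tail = trans (cong (Mcount k) (T1-+-2^suc* k r m)) (Mcount-+-2^* k (T1 r) (3 ^ oddInd r * m))

2^+≡+2^*1 : ∀ n r → 2 ^ n + r ≡ r + 2 ^ n * 1
2^+≡+2^*1 n r = trans (+-comm (2 ^ n) r) (cong (r +_) (sym (*-identityʳ (2 ^ n))))

Mcount-2^+ : ∀ n r → Mcount n (2 ^ n + r) ≡ Mcount n r
Mcount-2^+ n r = trans (cong (Mcount n) (2^+≡+2^*1 n r)) (Mcount-+-2^* n r 1)

oddInd-T1^-2^+ : ∀ n r → oddInd (T1^ n r) + oddInd (T1^ n (2 ^ n + r)) ≡ 1
oddInd-T1^-2^+ n r = begin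
  oddInd x + oddInd (T1^ n (2 ^ n + r))       ≡⟨ cong (λ b → oddInd x + oddInd (T1^ n b)) (2^+≡+2^*1 n r) ⟩
  oddInd x + oddInd (T1^ n (r + 2 ^ n * 1))   ≡⟨ cong (λ y → oddInd x + oddInd y) (T1^-+-2^* n r 1) ⟩
  oddInd x + oddInd (x + 3 ^ Mcount n r * 1)  ≡⟨ cong (oddInd x +_) (oddInd-+-3^* x (Mcount n r) 1) ⟩
  oddInd x + oddInd (x + 1)                   ≡⟨ cong (λ y → oddInd x + oddInd y) (+-comm x 1) ⟩
  oddInd x + oddInd (suc x)                   ≡⟨ oddInd-suc x ⟩
  1                                           ∎
  where
  open ≡-Reasoning
  x : ℕ
  x = T1^ n r

∑< : ℕ → (ℕ → ℕ) → ℕ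
∑< zero    f = 0
∑< (suc n) f = f 0 + ∑< n (f ∘ suc)

syntax ∑< n (λ i → e) = ∑[ i < n ] e

∑<-cong : ∀ n {f g : ℕ → ℕ} → (∀ i → f i ≡ g i) → ∑< n f ≡ ∑< n g
∑<-cong zero    f≗g = refl
∑<-cong (suc n) f≗g = cong₂ _+_ (f≗g 0) (∑<-cong n (f≗g ∘ suc))

∑<-const : ∀ n c → ∑[ _ < n ] c ≡ n * c
∑<-const zero    c = refl
∑<-const (suc n) c = cong (c +_) (∑<-const n c)

∑<-distrib-+ : ∀ n (f g : ℕ → ℕ) → ∑[ i < n ] (f i + g i) ≡ ∑< n f + ∑< n g
∑<-distrib-+ zero    f g = refl
∑<-distrib-+ (suc n) f g = begin
  f 0 + g 0 + ∑[ i < n ] (f (suc i) + g (suc i))  ≡⟨ cong (f 0 + g 0 +_) (∑<-distrib-+ n (f ∘ suc) (g ∘ suc)) ⟩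
  f 0 + g 0 + (∑< n (f ∘ suc) + ∑< n (g ∘ suc))  ≡⟨ +-comm-middle (f 0) (g 0) (∑< n (f ∘ suc)) (∑< n (g ∘ suc)) ⟩
  f 0 + ∑< n (f ∘ suc) + (g 0 + ∑< n (g ∘ suc))  ∎
  where
  open ≡-Reasoning
  +-comm-middle : ∀ a b c d → a + b + (c + d) ≡ a + c + (b + d)
  +-comm-middle = solve-∀

∑<-split : ∀ m n (f : ℕ → ℕ) → ∑< (m + n) f ≡ ∑< m f + ∑[ i < n ] f (m + i)
∑<-split zero    n f = refl
∑<-split (suc m) n f = trans (cong (f 0 +_) (∑<-split m n (f ∘ suc))) (sym (+-assoc (f 0) _ _))

∑<-2* : ∀ p (f : ℕ → ℕ) → ∑< (2 * p) f ≡ ∑< p f + ∑[ i < p ] f (p + i)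
∑<-2* p f = trans (cong (λ q → ∑< (p + q) f) (+-identityʳ p)) (∑<-split p p f)

Mtotal : ℕ → ℕ
Mtotal n = ∑< (2 ^ n) (Mcount n)

∑-oddInd-T1^ : ∀ n → ∑[ b < 2 ^ suc n ] oddInd (T1^ n b) ≡ 2 ^ n
∑-oddInd-T1^ n = begin
  ∑< (2 * 2 ^ n) (oddInd ∘ T1^ n)                                      ≡⟨ ∑<-2* (2 ^ n) (oddInd ∘ T1^ n) ⟩
  ∑[ r < 2 ^ n ] oddInd (T1^ n r) + ∑[ r < 2 ^ n ] oddInd (T1^ n (2 ^ n + r)) ≡⟨ ∑<-distrib-+ (2 ^ n) _ _ ⟨
  ∑[ r < 2 ^ n ] (oddInd (T1^ n r) + oddInd (T1^ n (2 ^ n + r)))           ≡⟨ ∑<-cong (2 ^ n) (oddInd-T1^-2^+ n) ⟩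
  ∑[ r < 2 ^ n ] 1                                                         ≡⟨ ∑<-const (2 ^ n) 1 ⟩
  2 ^ n * 1                                                                ≡⟨ *-identityʳ (2 ^ n) ⟩
  2 ^ n                                                                    ∎
  where open ≡-Reasoning

Mtotal-suc : ∀ n → Mtotal (suc n) ≡ 2 ^ n + 2 * Mtotal n
Mtotal-suc n = begin
  ∑[ b < 2 ^ suc n ] (oddInd (T1^ n b) + Mcount n b)               ≡⟨ ∑<-distrib-+ (2 ^ suc n) (oddInd ∘ T1^ n) (Mcount n) ⟩
  ∑[ b < 2 ^ suc n ] oddInd (T1^ n b) + ∑< (2 * 2 ^ n) (Mcount n)  ≡⟨ cong₂ _+_ (∑-oddInd-T1^ n) (∑<-2* (2 ^ n) (Mcount n)) ⟩
  2 ^ n + (Mtotal n + ∑[ r < 2 ^ n ] Mcount n (2 ^ n + r))         ≡⟨ cong (λ y → 2 ^ n + (Mtotal n + y)) (∑<-cong (2 ^ n) (Mcount-2^+ n)) ⟩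
  2 ^ n + (Mtotal n + Mtotal n)                                    ≡⟨ cong (λ y → 2 ^ n + (Mtotal n + y)) (+-identityʳ (Mtotal n)) ⟨
  2 ^ n + 2 * Mtotal n                                             ∎
  where open ≡-Reasoning

2*Mtotal≡n*2^n : ∀ n → 2 * Mtotal n ≡ n * 2 ^ n
2*Mtotal≡n*2^n zero    = refl
2*Mtotal≡n*2^n (suc n) = begin
  2 * Mtotal (suc n)          ≡⟨ cong (2 *_) (Mtotal-suc n) ⟩
  2 * (2 ^ n + 2 * Mtotal n)  ≡⟨ cong (λ y → 2 * (2 ^ n + y)) (2*Mtotal≡n*2^n n) ⟩
  2 * (2 ^ n + n * 2 ^ n)     ≡⟨ factor n (2 ^ n) ⟩
  suc n * (2 * 2 ^ n)         ∎
  where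
  open ≡-Reasoning
  factor : ∀ n x → 2 * (x + n * x) ≡ suc n * (2 * x)
  factor = solve-∀

n≤Mtotal : ∀ n → n ≤ Mtotal n
n≤Mtotal zero    = z≤n
n≤Mtotal (suc n) = ≤-trans (+-mono-≤ (m^n>0 2 n) (≤-trans (n≤Mtotal n) (m≤m+n (Mtotal n) _)))
                           (≤-reflexive (sym (Mtotal-suc n)))

3^n*[3+n]≤3*4^n : ∀ n → 3 ^ n * (3 + n) ≤ 3 * 4 ^ n
3^n*[3+n]≤3*4^n zero    = ≤-refl
3^n*[3+n]≤3*4^n (suc n) = begin
  3 * 3 ^ n * (4 + n)    ≡⟨ e₁ (3 ^ n) n ⟩
  3 ^ n * (12 + 3 * n)   ≤⟨ *-monoʳ-≤ (3 ^ n) (+-monoʳ-≤ 12 (*-monoˡ-≤ n (n≤1+n 3))) ⟩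
  3 ^ n * (12 + 4 * n)   ≡⟨ e₂ (3 ^ n) n ⟩
  4 * (3 ^ n * (3 + n))  ≤⟨ *-monoʳ-≤ 4 (3^n*[3+n]≤3*4^n n) ⟩
  4 * (3 * 4 ^ n)        ≡⟨ e₃ (4 ^ n) ⟩
  3 * (4 * 4 ^ n)        ∎
  where
  open ≤-Reasoning
  e₁ : ∀ x n → 3 * x * (4 + n) ≡ x * (12 + 3 * n)
  e₁ = solve-∀
  e₂ : ∀ x n → x * (12 + 4 * n) ≡ 4 * (x * (3 + n))
  e₂ = solve-∀
  e₃ : ∀ x → 4 * (3 * x) ≡ 3 * (4 * x)
  e₃ = solve-∀

3^n*d<4^n : ∀ n d → 3 * d ≤ n → 3 ^ n * d ℕ.< 4 ^ n
3^n*d<4^n n d 3d≤n = <-≤-trans (*-monoʳ-< (3 ^ n) {{m^n≢0 3 n}} (n<1+n d)) (*-cancelˡ-≤ 3 (begin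
  3 * (3 ^ n * (1 + d))  ≡⟨ e (3 ^ n) d ⟩
  3 ^ n * (3 + 3 * d)    ≤⟨ *-monoʳ-≤ (3 ^ n) (+-monoʳ-≤ 3 3d≤n) ⟩
  3 ^ n * (3 + n)        ≤⟨ 3^n*[3+n]≤3*4^n n ⟩
  3 * 4 ^ n              ∎))
  where
  open ≤-Reasoning
  e : ∀ x d → 3 * (x * (1 + d)) ≡ x * (3 + 3 * d)
  e = solve-∀

toℚᵘ-/ : ∀ i n .{{_ : NonZero n}} → toℚᵘ (i ℚ./ n) ≃ i ℚᵘ./ n
toℚᵘ-/ i (suc n) = ℚ.toℚᵘ-fromℚᵘ (mkℚᵘ i n)

/-*-/ : ∀ a b c d .{{_ : NonZero b}} .{{_ : NonZero d}} →
        (ℤ.+ a ℚᵘ./ b) ℚᵘ.* (ℤ.+ c ℚᵘ./ d) ≃ (ℤ.+ (a * c) ℚᵘ./ (b * d)) {{m*n≢0 b d}}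
/-*-/ a (suc b) c (suc d) = ℚᵘ.*≡* (cong (ℤ._* ℤ.+ (suc b * suc d)) (sym (ℤ.pos-* a c)))

∣+/∣ : ∀ a b .{{_ : NonZero b}} → ℚᵘ.∣ ℤ.+ a ℚᵘ./ b ∣ ≡ ℤ.+ a ℚᵘ./ b
∣+/∣ a (suc b) = refl

+/<ᵘ : ∀ a b d p .{{_ : NonZero b}} → a * suc d ℕ.< suc p * b → ℤ.+ a ℚᵘ./ b ℚᵘ.< mkℚᵘ +[1+ p ] d
+/<ᵘ a (suc b) d p lt = ℚᵘ.*<* (subst₂ ℤ._<_ (ℤ.pos-* a (suc d)) (ℤ.pos-* (suc p) (suc b)) (ℤ.+<+ lt))

toℚᵘ-prodℚ-^/ : ∀ c d .{{_ : NonZero d}} (e h : ℕ → ℕ) m →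
  toℚᵘ (prodℚ (map (λ x → ℤ.+ (c ^ e x) ℚ./ d) (applyUpTo h m)))
    ≃ (ℤ.+ (c ^ ∑< m (e ∘ h)) ℚᵘ./ (d ^ m)) {{m^n≢0 d m}}
toℚᵘ-prodℚ-^/ c d e h zero    = ℚᵘ.≃-refl
toℚᵘ-prodℚ-^/ c d e h (suc m) = begin
  toℚᵘ (q ℚ.* qs)                                ≈⟨ ℚ.toℚᵘ-homo-* q qs ⟩
  toℚᵘ q ℚᵘ.* toℚᵘ qs                            ≈⟨ ℚᵘ.*-cong (toℚᵘ-/ (ℤ.+ x) d) (toℚᵘ-prodℚ-^/ c d e (h ∘ suc) m) ⟩
  (ℤ.+ x ℚᵘ./ d) ℚᵘ.* (ℤ.+ xs ℚᵘ./ (d ^ m))      ≈⟨ /-*-/ x d xs (d ^ m) ⟩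
  (ℤ.+ (x * xs) ℚᵘ./ (d * d ^ m)) {{d*d^m≢0}}   ≡⟨ ℚᵘ./-cong {{d^suc-m≢0}} {{d*d^m≢0}} (cong ℤ.+_ (^-distribˡ-+-* c (e (h 0)) _)) refl ⟨
  (ℤ.+ (c ^ ∑< (suc m) (e ∘ h)) ℚᵘ./ (d ^ suc m)) {{d^suc-m≢0}}  ∎
  where
  open ℚᵘ.≃-Reasoning
  instance
    d^m≢0 : NonZero (d ^ m)
    d^m≢0 = m^n≢0 d m
  d*d^m≢0 : NonZero (d * d ^ m)
  d*d^m≢0 = m*n≢0 d (d ^ m)
  d^suc-m≢0 : NonZero (d ^ suc m)
  d^suc-m≢0 = m^n≢0 d (suc m)
  x xs : ℕ
  x = c ^ e (h 0)
  xs = c ^ ∑< m (e ∘ h ∘ suc)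
  q qs : ℚ
  q = ℤ.+ x ℚ./ d
  qs = prodℚ (map (λ x → ℤ.+ (c ^ e x) ℚ./ d) (applyUpTo (h ∘ suc) m))

toℚᵘ-K : ∀ n → toℚᵘ (K n) ≃ (ℤ.+ (3 ^ Mtotal n) ℚᵘ./ (4 ^ Mtotal n)) {{m^n≢0 4 (Mtotal n)}}
toℚᵘ-K n = ℚᵘ.≃-trans (toℚᵘ-prodℚ-^/ 3 (2 ^ n) (Mcount n) id (2 ^ n))
                      (ℚᵘ.≃-reflexive (ℚᵘ./-cong refl [2^n]^2^n≡4^Mtotal))
  where
  instance
    2^n≢0 : NonZero (2 ^ n)
    2^n≢0 = m^n≢0 2 n
    [2^n]^2^n≢0 : NonZero ((2 ^ n) ^ (2 ^ n))
    [2^n]^2^n≢0 = m^n≢0 (2 ^ n) (2 ^ n)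
    4^Mtotal≢0 : NonZero (4 ^ Mtotal n)
    4^Mtotal≢0 = m^n≢0 4 (Mtotal n)
  [2^n]^2^n≡4^Mtotal : (2 ^ n) ^ (2 ^ n) ≡ 4 ^ Mtotal n
  [2^n]^2^n≡4^Mtotal = begin
    (2 ^ n) ^ (2 ^ n)  ≡⟨ ^-*-assoc 2 n (2 ^ n) ⟩
    2 ^ (n * 2 ^ n)    ≡⟨ cong (2 ^_) (2*Mtotal≡n*2^n n) ⟨
    2 ^ (2 * Mtotal n) ≡⟨ ^-*-assoc 2 2 (Mtotal n) ⟨
    4 ^ Mtotal n       ∎
    where open ≡-Reasoning

toℚᵘ-∣K-0∣ : ∀ n → toℚᵘ ∣ K n - 0ℚ ∣ ≃ (ℤ.+ (3 ^ Mtotal n) ℚᵘ./ (4 ^ Mtotal n)) {{m^n≢0 4 (Mtotal n)}}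
toℚᵘ-∣K-0∣ n = begin
  toℚᵘ ∣ K n - 0ℚ ∣                     ≡⟨ cong (toℚᵘ ∘ ∣_∣) (ℚ.+-identityʳ (K n)) ⟩
  toℚᵘ ∣ K n ∣                          ≈⟨ ℚ.toℚᵘ-homo-∣-∣ (K n) ⟩
  ℚᵘ.∣ toℚᵘ (K n) ∣                     ≈⟨ ℚᵘ.∣-∣-cong (toℚᵘ-K n) ⟩
  ℚᵘ.∣ ℤ.+ (3 ^ S) ℚᵘ./ (4 ^ S) ∣       ≡⟨ ∣+/∣ (3 ^ S) (4 ^ S) ⟩
  ℤ.+ (3 ^ S) ℚᵘ./ (4 ^ S)              ∎
  where
  open ℚᵘ.≃-Reasoning
  S : ℕ
  S = Mtotal n
  instance
    4^S≢0 : NonZero (4 ^ S)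
    4^S≢0 = m^n≢0 4 S

mainTheorem4 : (ε : ℚ) → 0ℚ < ε → ∃[ N ] ((n : ℕ) → N ≤ n → ∣ K n - 0ℚ ∣ < ε)
mainTheorem4 (mkℚ +[1+ p ] d _) _ = 3 * suc d , λ n N≤n →
  ℚ.toℚᵘ-cancel-< (ℚᵘ.<-respˡ-≃ (ℚᵘ.≃-sym (toℚᵘ-∣K-0∣ n)) (+/<ᵘ _ _ d p {{m^n≢0 4 (Mtotal n)}}
    (<-≤-trans (3^n*d<4^n (Mtotal n) (suc d) (≤-trans N≤n (n≤Mtotal n))) (m≤n*m (4 ^ Mtotal n) (suc p)))))
mainTheorem4 (mkℚ +0       _ _) (ℚ.*<* (ℤ.+<+ ()))
mainTheorem4 (mkℚ -[1+ _ ] _ _) (ℚ.*<* ())
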